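{- Let $m\geq2$ and let $p,r\geq0$ be integers. If there exists a planar $m$-constellation with boundary condition $$\underbrace{\bullet\bullet\cdots\bullet}_{p}\underbrace{\circ\bullet\circ\bullet\cdots\circ\bullet}_{2r},$$ then $m$ divides $p$. Equivalently, the generating function $M_{p,r}$ of such $m$-constellations (with weight $t$ per vertex, weight $1$ per black inner face, and weight $x_i$ per white inner face of degree $mi$) vanishes unless $m$ divides $p$.
   Context: A planar map with a boundary is a planar map with a distinguished rooted face (the boundary, with a distinguished root corner); other faces are inner faces. A hypermap with a boundary is such a map whose inner faces are colored black or white so that adjacent inner faces have different colors. For a word $w=w_1\cdots w_\ell$ on $\{\bullet,\circ\}$, a hypermap with boundary condition $w$ has boundary length $\ell$ and, walking clockwise from the root corner: (1) if the $i$-th edge visited is incident to an inner face, that face is white if $w_i=\bullet$ and black if $w_i=\circ$; (2) if an edge is incident to the boundary on both sides and visited at steps $i$ and $j$, then $w_i\neq w_j$. An $m$-constellation is a hypermap with a boundary in which every black inner face has degree $m$ and every white inner face has degree a multiple of $m$. -}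

module Defs where

open import Data.Nat using (ℕ; zero; suc; _+_; _*_; _≤_)
open import Data.Nat.Divisibility using (_∣_)
open import Data.Fin using (Fin; toℕ) renaming (zero to fzero; suc to fsuc)
open import Data.Fin.Properties using (any?; all?; _≟_)
open import Data.Fin.Permutation using (Permutation′; _⟨$⟩ʳ_)
open import Data.List using (List; []; _∷_; length; lookup; replicate; concat; _++_)
open import Data.Product using (Σ; ∃; ∃-syntax; _×_; _,_)
open import Data.Bool using (if_then_else_)
open import Relation.Nullary using (¬_; Dec; does)
open import Relation.Binary.PropositionalEquality using (_≡_; _≢_)
import Data.Nat.Properties as ℕP

-- Boundary letters: ● is "•" (bullet), ○ is "∘" (circ).
data Sym : Set where
  ● ○ : Sym

data Colour : Set where
  black white : Colour

iter : ∀ {A : Set} → (A → A) → ℕ → A → A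
iter f zero    x = x
iter f (suc k) x = f (iter f k x)

count : ∀ {n} (P : Fin n → Set) → (∀ i → Dec (P i)) → ℕ
count {zero}  P P? = 0
count {suc n} P P? =
  (if does (P? fzero) then 1 else 0) + count (λ i → P (fsuc i)) (λ i → P? (fsuc i))

-- For a permutation f of Fin n: y lies in the f-orbit (cycle) of x.
-- (Every cycle has length ≤ n, so exponents k < n suffice.)
InOrbit : ∀ {n} → (Fin n → Fin n) → Fin n → Fin n → Set
InOrbit {n} f x y = ∃[ k ] iter f (toℕ {n} k) x ≡ y

inOrbit? : ∀ {n} (f : Fin n → Fin n) x y → Dec (InOrbit f x y)
inOrbit? f x y = any? (λ k → iter f (toℕ k) x ≟ y)

cycleSize : ∀ {n} → (Fin n → Fin n) → Fin n → ℕ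
cycleSize f x = count (InOrbit f x) (inOrbit? f x)

-- x is the smallest element of its cycle (one representative per cycle)
CycleMin : ∀ {n} → (Fin n → Fin n) → Fin n → Set
CycleMin {n} f x = ∀ (k : Fin n) → toℕ x ≤ toℕ (iter f (toℕ k) x)

cycleMin? : ∀ {n} (f : Fin n → Fin n) x → Dec (CycleMin f x)
cycleMin? f x = all? (λ k → toℕ x ℕP.≤? toℕ (iter f (toℕ k) x))

numCycles : ∀ {n} → (Fin n → Fin n) → ℕ
numCycles f = count (CycleMin f) (cycleMin? f)

-- Combinatorial maps: darts Fin n, σ = rotation around vertices,
-- α = fixed-point-free involution (edges), φ = σ ∘ α (faces).

record CombMap (n : ℕ) : Set where
  field
    σ α     : Permutation′ n
    α-invol : ∀ d → α ⟨$⟩ʳ (α ⟨$⟩ʳ d) ≡ d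
    α-fpf   : ∀ d → α ⟨$⟩ʳ d ≢ d

module _ {n : ℕ} (M : CombMap n) where
  open CombMap M

  σf αf φ : Fin n → Fin n
  σf d = σ ⟨$⟩ʳ d
  αf d = α ⟨$⟩ʳ d
  φ  d = σ ⟨$⟩ʳ (α ⟨$⟩ʳ d)

  data Reach : Fin n → Fin n → Set where
    here  : ∀ {x} → Reach x x
    viaσ  : ∀ {x y} → Reach x y → Reach x (σf y)
    viaα  : ∀ {x y} → Reach x y → Reach x (αf y)

  Connected : Set
  Connected = ∀ x y → Reach x y

  numVertices numFaces : ℕ
  numVertices = numCycles σf
  numFaces    = numCycles φ

  faceDeg : Fin n → ℕ
  faceDeg d = cycleSize φ d

  -- planar: connected and Euler's formula V - E + F = 2 with E = n/2
  Planar : Set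
  Planar = Connected × (2 * (numVertices + numFaces) ≡ n + 4)

-- Planar hypermap with a boundary (root dart = root corner of the boundary face)

record PlanarHypermapWB : Set where
  field
    n       : ℕ
    M       : CombMap n
    planar  : Planar M
    root    : Fin n
    colour  : Fin n → Colour   -- colour of the face containing a dart

  InBoundary : Fin n → Set
  InBoundary d = InOrbit (φ M) root d

  Inner : Fin n → Set
  Inner d = ¬ InBoundary d

  field
    colour-face : ∀ d → Inner d → colour (φ M d) ≡ colour d
    proper      : ∀ d → Inner d → Inner (αf M d) → colour d ≢ colour (αf M d)

  boundaryLength : ℕ
  boundaryLength = faceDeg M root

  bdart : ℕ → Fin n
  bdart i = iter (φ M) i root

open PlanarHypermapWB public

-- letter ● demands a white inner face on the other side, ○ a black one
expected : Sym → Colour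
expected ● = white
expected ○ = black

HasBoundaryCondition : PlanarHypermapWB → List Sym → Set
HasBoundaryCondition H w =
  Σ (boundaryLength H ≡ length w) λ _ →
    (∀ (i : Fin (length w)) → Inner H (αf (M H) (bdart H (toℕ i))) →
        colour H (αf (M H) (bdart H (toℕ i))) ≡ expected (lookup w i))
  × (∀ (i j : Fin (length w)) →
        αf (M H) (bdart H (toℕ i)) ≡ bdart H (toℕ j) → lookup w i ≢ lookup w j)

IsConstellation : ℕ → PlanarHypermapWB → Set
IsConstellation m H =
    (∀ d → Inner H d → colour H d ≡ black → faceDeg (M H) d ≡ m)
  × (∀ d → Inner H d → colour H d ≡ white → m ∣ faceDeg (M H) d)

bword : ℕ → ℕ → List Sym
bword p r = replicate p ● ++ concat (replicate r (○ ∷ ● ∷ []))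

{-# OPTIONS --safe #-}
module Submission where

-- Give every dart the colour of its side of the edge: a dart of an inner face gets the
-- colour of that face, and a boundary dart carrying the letter s gets the colour opposite
-- to the one s prescribes across the edge (● counts as black, ○ as white).  Properness and
-- the two boundary conditions say exactly that the edge involution α exchanges the two
-- colours, so there are as many white darts as black ones.  The white darts are those of
-- white inner faces plus the ○-positions of the word, the black darts those of black inner
-- faces plus the ●-positions; for •^p (∘•)^r this reads W + r = B + p + r.  In an
-- m-constellation every inner face has degree divisible by m, so m divides W and B.

open import Defs
open import Data.Bool using (if_then_else_)
open import Data.Empty using (⊥-elim)
open import Data.Fin using (Fin; toℕ; fromℕ<; inject≤) renaming (zero to fzero; suc to fsuc)
open import Data.Fin.Permutation using (Permutation′; _⟨$⟩ʳ_)
open import Data.Fin.Properties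
  using (any?; _≟_; suc-injective; ¬Fin0; 0≢1+n; toℕ-injective; toℕ<n; toℕ-fromℕ<; toℕ-inject≤; pigeonhole)
open import Data.List using (List; []; _∷_; length; lookup; replicate; concat; _++_)
open import Data.Nat using (ℕ; zero; suc; _+_; _*_; _∸_; _≤_; _<_; z≤n; s≤s; _<?_; _%_; _/_; NonZero; >-nonZero)
open import Data.Nat.DivMod using (m≡m%n+[m/n]*n; m%n<n)
open import Data.Nat.Divisibility using (_∣_; ∣-reflexive; _∣0; ∣m∣n⇒∣m+n; ∣m+n∣m⇒∣n)
import Data.Nat.Properties as ℕ
open import Data.Product using (Σ; ∃-syntax; _×_; _,_; proj₁; proj₂)
open import Data.Sum using (_⊎_; inj₁; inj₂)
open import Function using (_∘_)
open import Function.Bundles using (Injection)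
open import Function.Definitions using (Injective)
open import Function.Properties.Inverse using (↔⇒↣)
open import Relation.Binary using (tri<; tri≈; tri>)
open import Relation.Binary.PropositionalEquality
  using (_≡_; _≢_; refl; sym; trans; cong; cong₂; subst; module ≡-Reasoning)
open import Relation.Nullary using (¬_; Dec; does; yes; no)
open import Relation.Nullary.Decidable using (_×-dec_; ¬?)
open import Relation.Unary using (Pred; Decidable; U; _∩_; _∪_; ∁; _⊆_; _≐_)
open import Relation.Unary.Properties using (U?; _∩?_; _∪?_; ∁?)
open import Algebra.Properties.CommutativeMonoid.Sum ℕ.+-0-commutativeMonoid using (sum; sum-permute)
open import Algebra.Properties.CommutativeSemigroup ℕ.+-commutativeSemigroup
  using () renaming (interchange to +-interchange)

-- Counting decidable subsets of Fin n

indicator : ∀ {P : Set} → Dec P → ℕ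
indicator P? = if does P? then 1 else 0

indicator-cong : ∀ {P Q : Set} (P? : Dec P) (Q? : Dec Q) → (P → Q) → (Q → P) → indicator P? ≡ indicator Q?
indicator-cong (yes _) (yes _) _   _   = refl
indicator-cong (yes p) (no ¬q) P→Q _   = ⊥-elim (¬q (P→Q p))
indicator-cong (no ¬p) (yes q) _   Q→P = ⊥-elim (¬p (Q→P q))
indicator-cong (no _)  (no _)  _   _   = refl

indicator-no : ∀ {P : Set} (P? : Dec P) → ¬ P → indicator P? ≡ 0
indicator-no (yes p) ¬p = ⊥-elim (¬p p)
indicator-no (no _)  _  = refl

indicator-split : ∀ {P Q : Set} (P? : Dec P) (Q? : Dec Q) →
  indicator P? ≡ indicator (P? ×-dec Q?) + indicator (P? ×-dec ¬? Q?)
indicator-split (yes _) (yes _) = refl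
indicator-split (yes _) (no _)  = refl
indicator-split (no _)  _       = refl

count-cong : ∀ {n} {P Q : Pred (Fin n) _} (P? : Decidable P) (Q? : Decidable Q) →
  P ≐ Q → count P P? ≡ count Q Q?
count-cong {zero}  P? Q? _ = refl
count-cong {suc n} P? Q? (P⊆Q , Q⊆P) =
  cong₂ _+_ (indicator-cong (P? fzero) (Q? fzero) P⊆Q Q⊆P)
            (count-cong (P? ∘ fsuc) (Q? ∘ fsuc) (P⊆Q , Q⊆P))

count-none : ∀ {n} {P : Pred (Fin n) _} (P? : Decidable P) → (∀ i → ¬ P i) → count P P? ≡ 0
count-none {zero}  P? _  = refl
count-none {suc n} P? ¬P = cong₂ _+_ (indicator-no (P? fzero) (¬P fzero)) (count-none (P? ∘ fsuc) (¬P ∘ fsuc))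

count-split : ∀ {n} {P Q : Pred (Fin n) _} (P? : Decidable P) (Q? : Decidable Q) →
  count P P? ≡ count (P ∩ Q) (P? ∩? Q?) + count (P ∩ ∁ Q) (P? ∩? ∁? Q?)
count-split {zero}  P? Q? = refl
count-split {suc n} P? Q? =
  trans (cong₂ _+_ (indicator-split (P? fzero) (Q? fzero)) (count-split (P? ∘ fsuc) (Q? ∘ fsuc)))
        (+-interchange (indicator (P? fzero ×-dec Q? fzero)) (indicator (P? fzero ×-dec ¬? (Q? fzero))) _ _)

count≡sum : ∀ {n} {P : Pred (Fin n) _} (P? : Decidable P) → count P P? ≡ sum (indicator ∘ P?)
count≡sum {zero}  P? = refl
count≡sum {suc n} P? = cong (indicator (P? fzero) +_) (count≡sum (P? ∘ fsuc))

count-permute : ∀ {n} {P : Pred (Fin n) _} (P? : Decidable P) (π : Permutation′ n) →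
  count P P? ≡ count (P ∘ (π ⟨$⟩ʳ_)) (P? ∘ (π ⟨$⟩ʳ_))
count-permute P? π =
  trans (count≡sum P?) (trans (sum-permute (indicator ∘ P?) π) (sym (count≡sum (P? ∘ (π ⟨$⟩ʳ_)))))

count-single : ∀ {n} {P : Pred (Fin n) _} (P? : Decidable P) (x : Fin n) →
  count (P ∩ (_≡ x)) (P? ∩? (_≟ x)) ≡ indicator (P? x)
count-single {suc n} P? fzero =
  trans (cong₂ _+_ (indicator-cong (P? fzero ×-dec (fzero {n} ≟ fzero)) (P? fzero) proj₁ (_, refl))
                   (count-none (λ i → P? (fsuc i) ×-dec (fsuc i ≟ fzero)) λ { _ (_ , ()) }))
        (ℕ.+-identityʳ _)
count-single {suc n} P? (fsuc x) =
  cong₂ _+_ (indicator-no (P? fzero ×-dec (fzero ≟ fsuc x)) λ { (_ , ()) })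
            (trans (count-cong (λ i → P? (fsuc i) ×-dec (fsuc i ≟ fsuc x)) (λ i → P? (fsuc i) ×-dec (i ≟ x))
                      ((λ (p , e) → p , suc-injective e) , λ (p , e) → p , cong fsuc e))
                   (count-single (P? ∘ fsuc) x))

count-image : ∀ {L n} (g : Fin L → Fin n) → Injective _≡_ _≡_ g →
  {B Q : Pred (Fin n) _} (B? : Decidable B) (Q? : Decidable Q) →
  (∀ {d} → B d → ∃[ i ] g i ≡ d) → (∀ i → B (g i)) →
  count (B ∩ Q) (B? ∩? Q?) ≡ count (Q ∘ g) (Q? ∘ g)
count-image {zero} g _ B? Q? onto _ = count-none (B? ∩? Q?) λ _ (b , _) → ¬Fin0 (proj₁ (onto b))
count-image {suc L} g g-inj {B} {Q} B? Q? onto inB =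
  trans (count-split (B? ∩? Q?) (_≟ g fzero))
        (cong₂ _+_ at-g₀ off-g₀)
  where
  at-g₀ : count ((B ∩ Q) ∩ (_≡ g fzero)) ((B? ∩? Q?) ∩? (_≟ g fzero)) ≡ indicator (Q? (g fzero))
  at-g₀ = trans (count-single (B? ∩? Q?) (g fzero)) (indicator-cong ((B? ∩? Q?) (g fzero)) (Q? (g fzero)) proj₂ (inB fzero ,_))
  B′ : Pred (Fin _) _
  B′ = B ∩ ∁ (_≡ g fzero)
  onto′ : ∀ {d} → B′ d → ∃[ i ] g (fsuc i) ≡ d
  onto′ (b , d≢g0) with onto b
  ... | fzero  , e = ⊥-elim (d≢g0 (sym e))
  ... | fsuc i , e = i , e
  off-g₀ : count ((B ∩ Q) ∩ ∁ (_≡ g fzero)) ((B? ∩? Q?) ∩? ∁? (_≟ g fzero)) ≡ count (Q ∘ g ∘ fsuc) (Q? ∘ g ∘ fsuc)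
  off-g₀ = trans (count-cong _ ((B? ∩? ∁? (_≟ g fzero)) ∩? Q?) ((λ ((b , q) , ne) → (b , ne) , q) , λ ((b , ne) , q) → (b , q) , ne))
               (count-image (g ∘ fsuc) (suc-injective ∘ g-inj) (B? ∩? ∁? (_≟ g fzero)) Q? onto′
                  (λ i → inB (fsuc i) , 0≢1+n ∘ sym ∘ g-inj))

count-U : ∀ n → count {n} U U? ≡ n
count-U zero    = refl
count-U (suc n) = cong suc (count-U n)

least-witness : ∀ {P : ℕ → Set} → Decidable P → ∀ {n} → P n →
  ∃[ k ] k ≤ n × P k × (∀ {j} → j < k → ¬ P j)
least-witness P? {zero} p = 0 , z≤n , p , λ ()
least-witness P? {suc n} p with P? 0
... | yes p₀ = 0 , z≤n , p₀ , λ ()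
... | no ¬p₀ with least-witness (P? ∘ suc) p
...   | k , k≤n , pₖ , below = suc k , s≤s k≤n , pₖ , λ { {zero} _ → ¬p₀ ; {suc j} (s≤s j<k) → below j<k }

-- Orbits of an injection of Fin n

iter-+ : ∀ {A : Set} (f : A → A) a b x → iter f (a + b) x ≡ iter f a (iter f b x)
iter-+ f zero    b x = refl
iter-+ f (suc a) b x = cong f (iter-+ f a b x)

iter-preserves : ∀ {ℓ} {A : Set} {f : A → A} {S : Pred A ℓ} →
  (∀ {d} → S d → S (f d)) → ∀ k {x} → S x → S (iter f k x)
iter-preserves invariant zero    s = s
iter-preserves {f = f} {S} invariant (suc k) s = invariant (iter-preserves {f = f} {S} invariant k s)

module Orbits {n : ℕ} {f : Fin n → Fin n} (f-injective : Injective _≡_ _≡_ f) where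

  iter-injective : ∀ a → Injective _≡_ _≡_ (iter f a)
  iter-injective zero    e = e
  iter-injective (suc a) e = iter-injective a (f-injective e)

  iter-∸ : ∀ {a b} x → a ≤ b → iter f a x ≡ iter f b x → iter f (b ∸ a) x ≡ x
  iter-∸ {a} {b} x a≤b e = sym (iter-injective a (begin
    iter f a x                 ≡⟨ e ⟩
    iter f b x                 ≡⟨ cong (λ k → iter f k x) (sym (ℕ.m+[n∸m]≡n a≤b)) ⟩
    iter f (a + (b ∸ a)) x     ≡⟨ iter-+ f a (b ∸ a) x ⟩
    iter f a (iter f (b ∸ a) x) ∎))
    where open ≡-Reasoning

  record IsPeriod (x : Fin n) (q : ℕ) : Set where
    field
      positive : 0 < q
      returns  : iter f q x ≡ x
      minimal  : ∀ {k} → 0 < k → k < q → iter f k x ≢ x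

  module _ {x : Fin n} {q : ℕ} (period : IsPeriod x q) where
    open IsPeriod period

    private instance
      q-nonZero : NonZero q
      q-nonZero = >-nonZero positive

    iter-*-period : ∀ b → iter f (b * q) x ≡ x
    iter-*-period zero    = refl
    iter-*-period (suc b) = trans (iter-+ f q (b * q) x) (trans (cong (iter f q) (iter-*-period b)) returns)

    iter-%-period : ∀ k → iter f k x ≡ iter f (k % q) x
    iter-%-period k = begin
      iter f k x                                ≡⟨ cong (λ j → iter f j x) (m≡m%n+[m/n]*n k q) ⟩
      iter f (k % q + k / q * q) x              ≡⟨ iter-+ f (k % q) (k / q * q) x ⟩
      iter f (k % q) (iter f (k / q * q) x)     ≡⟨ cong (iter f (k % q)) (iter-*-period (k / q)) ⟩
      iter f (k % q) x                          ∎
      where open ≡-Reasoning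

    iter-reduce : ∀ k → ∃[ r ] iter f k x ≡ iter f (toℕ {q} r) x
    iter-reduce k = fromℕ< (m%n<n k q) , trans (iter-%-period k) (cong (λ j → iter f j x) (sym (toℕ-fromℕ< (m%n<n k q))))

    iter-distinct-below : ∀ {a b} → a < b → b < q → iter f a x ≢ iter f b x
    iter-distinct-below {a} {b} a<b b<q e =
      minimal (ℕ.m<n⇒0<n∸m a<b) (ℕ.≤-<-trans (ℕ.m∸n≤m b a) b<q) (iter-∸ x (ℕ.<⇒≤ a<b) e)

    iter-injective-below : Injective _≡_ _≡_ (λ (i : Fin q) → iter f (toℕ i) x)
    iter-injective-below {i} {j} e with ℕ.<-cmp (toℕ i) (toℕ j)
    ... | tri< i<j _ _ = ⊥-elim (iter-distinct-below i<j (toℕ<n j) e)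
    ... | tri≈ _ i≡j _ = toℕ-injective i≡j
    ... | tri> _ _ j<i = ⊥-elim (iter-distinct-below j<i (toℕ<n i) (sym e))

    iter-onto-orbit : ∀ {y} → InOrbit f x y → ∃[ i ] iter f (toℕ {q} i) x ≡ y
    iter-onto-orbit (k , e) with iter-reduce (toℕ k)
    ... | r , e′ = r , trans (sym e′) e

  period-exists : ∀ x → ∃[ q ] q ≤ n × IsPeriod x q
  period-exists x with pigeonhole (ℕ.n<1+n n) (λ k → iter f (toℕ k) x)
  ... | i , j , i<j , e
    with least-witness (λ k → (0 <? k) ×-dec (iter f k x ≟ x)) (ℕ.m<n⇒0<n∸m i<j , iter-∸ x (ℕ.<⇒≤ i<j) e)
  ... | q , q≤j∸i , (q>0 , returns) , below =
    q , ℕ.≤-trans q≤j∸i (ℕ.≤-trans (ℕ.m∸n≤m (toℕ j) (toℕ i)) (ℕ.≤-pred (toℕ<n j))) ,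
    record { positive = q>0 ; returns = returns ; minimal = λ k>0 k<q e → below k<q (k>0 , e) }

  ∈orbit-iter : ∀ x k → InOrbit f x (iter f k x)
  ∈orbit-iter x k with period-exists x
  ... | q , q≤n , period with iter-reduce period k
  ...   | r , e = inject≤ r q≤n , trans (cong (λ j → iter f j x) (toℕ-inject≤ r q≤n)) (sym e)

  ∈orbit-pred : ∀ {x y} → InOrbit f x (f y) → InOrbit f x y
  ∈orbit-pred {x} {y} (a , e) with period-exists y
  ... | q , _ , period = subst (InOrbit f x) back (∈orbit-iter x (q ∸ 1 + toℕ a))
    where
    open IsPeriod period
    open ≡-Reasoning
    back : iter f (q ∸ 1 + toℕ a) x ≡ y
    back = begin
      iter f (q ∸ 1 + toℕ a) x      ≡⟨ iter-+ f (q ∸ 1) (toℕ a) x ⟩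
      iter f (q ∸ 1) (iter f (toℕ a) x) ≡⟨ cong (iter f (q ∸ 1)) e ⟩
      iter f (q ∸ 1) (f y)          ≡⟨ sym (iter-+ f (q ∸ 1) 1 y) ⟩
      iter f (q ∸ 1 + 1) y          ≡⟨ cong (λ k → iter f k y) (ℕ.m∸n+n≡m positive) ⟩
      iter f q y                    ≡⟨ returns ⟩
      y                             ∎

  count-orbit : ∀ {x q} → IsPeriod x q → {Q : Pred (Fin n) _} (Q? : Decidable Q) →
    count (InOrbit f x ∩ Q) (inOrbit? f x ∩? Q?) ≡ count (λ i → Q (iter f (toℕ {q} i) x)) (λ i → Q? (iter f (toℕ i) x))
  count-orbit {x} period Q? =
    count-image _ (iter-injective-below period) (inOrbit? f x) Q? (iter-onto-orbit period) (∈orbit-iter x ∘ toℕ)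

  cycleSize-isPeriod : ∀ x → IsPeriod x (cycleSize f x)
  cycleSize-isPeriod x with period-exists x
  ... | q , _ , period = subst (IsPeriod x) (sym cycleSize≡q) period
    where
    cycleSize≡q : cycleSize f x ≡ q
    cycleSize≡q = trans (count-cong (inOrbit? f x) (inOrbit? f x ∩? U?) ((_, _) , proj₁))
                        (trans (count-orbit period U?) (count-U q))

  count-invariant-divisible : ∀ m {S : Pred (Fin n) _} (S? : Decidable S) → (∀ {d} → S d → S (f d)) →
    (∀ {d} → S d → m ∣ cycleSize f d) → m ∣ count S S?
  count-invariant-divisible m S? = go (suc (count _ S?)) S? (ℕ.n<1+n _)
    where
    go : ∀ N {S : Pred (Fin n) _} (S? : Decidable S) → count S S? < N → (∀ {d} → S d → S (f d)) →
      (∀ {d} → S d → m ∣ cycleSize f d) → m ∣ count S S?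
    go (suc N) {S} S? (s≤s bound) invariant divides with any? S?
    ... | no ∄S = subst (m ∣_) (sym (count-none S? λ d s → ∄S (d , s))) (m ∣0)
    ... | yes (x , sx) =
      subst (m ∣_) (sym split) (∣m∣n⇒∣m+n (divides sx) (go N S′? rest<N invariant′ (divides ∘ proj₁)))
      where
      S′ : Pred (Fin n) _
      S′ = S ∩ ∁ (InOrbit f x)
      S′? : Decidable S′
      S′? = S? ∩? ∁? (inOrbit? f x)
      orbit⊆S : InOrbit f x ⊆ S
      orbit⊆S (k , e) = subst S e (iter-preserves {f = f} {S} invariant (toℕ k) sx)
      split : count S S? ≡ cycleSize f x + count S′ S′?
      split = trans (count-split S? (inOrbit? f x))
                    (cong (_+ count S′ S′?) (count-cong _ (inOrbit? f x) (proj₂ , λ o → orbit⊆S o , o)))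
      rest<N : count S′ S′? < N
      rest<N = ℕ.<-≤-trans (subst (count S′ S′? <_) (sym split) (ℕ.m<n+m _ (IsPeriod.positive (cycleSize-isPeriod x)))) bound
      invariant′ : ∀ {d} → S′ d → S′ (f d)
      invariant′ (s , ∉orbit) = invariant s , ∉orbit ∘ ∈orbit-pred

φ-injective : ∀ {n} (M : CombMap n) → Injective _≡_ _≡_ (φ M)
φ-injective M = Injection.injective (↔⇒↣ α) ∘ Injection.injective (↔⇒↣ σ)
  where open CombMap M

-- Colours and boundary words

opposite : Colour → Colour
opposite black = white
opposite white = black

opposite-involutive : ∀ c → opposite (opposite c) ≡ c
opposite-involutive black = refl
opposite-involutive white = refl

≢⇒≡opposite : ∀ {a b} → a ≢ b → a ≡ opposite b
≢⇒≡opposite {black} {black} a≢b = ⊥-elim (a≢b refl)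
≢⇒≡opposite {black} {white} _   = refl
≢⇒≡opposite {white} {black} _   = refl
≢⇒≡opposite {white} {white} a≢b = ⊥-elim (a≢b refl)

_≟ᶜ_ : (a b : Colour) → Dec (a ≡ b)
black ≟ᶜ black = yes refl
black ≟ᶜ white = no λ ()
white ≟ᶜ black = no λ ()
white ≟ᶜ white = yes refl

sideColour : Sym → Colour
sideColour s = opposite (expected s)

sideColour≡⇒expected : ∀ {s c} → sideColour s ≡ c → expected s ≡ opposite c
sideColour≡⇒expected {s} refl = sym (opposite-involutive (expected s))

sideColour-distinct : ∀ {s t} → s ≢ t → sideColour s ≡ expected t
sideColour-distinct {●} {●} s≢t = ⊥-elim (s≢t refl)
sideColour-distinct {●} {○} _   = refl
sideColour-distinct {○} {●} _   = refl
sideColour-distinct {○} {○} s≢t = ⊥-elim (s≢t refl)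

occurrences : Colour → List Sym → ℕ
occurrences c w = count (λ j → sideColour (lookup w j) ≡ c) (λ j → sideColour (lookup w j) ≟ᶜ c)

occurrences-++ : ∀ c u v → occurrences c (u ++ v) ≡ occurrences c u + occurrences c v
occurrences-++ c []      v = refl
occurrences-++ c (s ∷ u) v = trans (cong (indicator (sideColour s ≟ᶜ c) +_) (occurrences-++ c u v))
                                   (sym (ℕ.+-assoc (indicator (sideColour s ≟ᶜ c)) _ _))

occurrences-●-black : ∀ p → occurrences black (replicate p ●) ≡ p
occurrences-●-black zero    = refl
occurrences-●-black (suc p) = cong suc (occurrences-●-black p)

occurrences-●-white : ∀ p → occurrences white (replicate p ●) ≡ 0
occurrences-●-white zero    = refl
occurrences-●-white (suc p) = occurrences-●-white p

occurrences-alternating : ∀ c r → occurrences c (concat (replicate r (○ ∷ ● ∷ []))) ≡ r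
occurrences-alternating c     zero    = refl
occurrences-alternating black (suc r) = cong suc (occurrences-alternating black r)
occurrences-alternating white (suc r) = cong suc (occurrences-alternating white r)

occurrences-black-bword : ∀ p r → occurrences black (bword p r) ≡ p + r
occurrences-black-bword p r =
  trans (occurrences-++ black (replicate p ●) _) (cong₂ _+_ (occurrences-●-black p) (occurrences-alternating black r))

occurrences-white-bword : ∀ p r → occurrences white (bword p r) ≡ r
occurrences-white-bword p r =
  trans (occurrences-++ white (replicate p ●) _) (cong₂ _+_ (occurrences-●-white p) (occurrences-alternating white r))

-- Hypermaps with a boundary

module Hypermap (H : PlanarHypermapWB) where
  open CombMap (M H) using (α-invol) renaming (α to α-permutation)
  open Orbits (φ-injective (M H))

  private
    Dart = Fin (n H)
    α = αf (M H)

  inBoundary? : Decidable (InBoundary H)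
  inBoundary? = inOrbit? (φ (M H)) (root H)

  InFaceOf : Colour → Pred Dart _
  InFaceOf c = Inner H ∩ λ d → colour H d ≡ c

  InFaceOf? : ∀ c → Decidable (InFaceOf c)
  InFaceOf? c = ∁? inBoundary? ∩? λ d → colour H d ≟ᶜ c

  InFaceOf-φ : ∀ {c d} → InFaceOf c d → InFaceOf c (φ (M H) d)
  InFaceOf-φ {d = d} (inner , colour≡c) = inner ∘ ∈orbit-pred , trans (colour-face H d inner) colour≡c

  constellation-divisible : ∀ {m} → IsConstellation m H → ∀ c → m ∣ count (InFaceOf c) (InFaceOf? c)
  constellation-divisible {m} (black-degree , white-degree) c =
    count-invariant-divisible m (InFaceOf? c) InFaceOf-φ (face-divisible c)
    where
    face-divisible : ∀ c {d} → InFaceOf c d → m ∣ cycleSize (φ (M H)) d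
    face-divisible black (inner , is-black) = ∣-reflexive (sym (black-degree _ inner is-black))
    face-divisible white (inner , is-white) = white-degree _ inner is-white

  module _ (w : List Sym) (boundary : HasBoundaryCondition H w) where

    boundaryDart : Fin (length w) → Dart
    boundaryDart j = bdart H (toℕ j)

    private
      length≡ : boundaryLength H ≡ length w
      length≡ = proj₁ boundary

      inner-across : ∀ j → Inner H (α (boundaryDart j)) → colour H (α (boundaryDart j)) ≡ expected (lookup w j)
      inner-across = proj₁ (proj₂ boundary)

      letters-distinct : ∀ j k → α (boundaryDart j) ≡ boundaryDart k → lookup w j ≢ lookup w k
      letters-distinct = proj₂ (proj₂ boundary)

    boundary-isPeriod : IsPeriod (root H) (length w)
    boundary-isPeriod = subst (IsPeriod (root H)) length≡ (cycleSize-isPeriod (root H))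

    boundaryDart-∈ : ∀ j → InBoundary H (boundaryDart j)
    boundaryDart-∈ j = ∈orbit-iter (root H) (toℕ j)

    OnBoundarySide : Colour → Pred Dart _
    OnBoundarySide c d = ∃[ j ] boundaryDart j ≡ d × sideColour (lookup w j) ≡ c

    OnBoundarySide? : ∀ c → Decidable (OnBoundarySide c)
    OnBoundarySide? c d = any? λ j → (boundaryDart j ≟ d) ×-dec (sideColour (lookup w j) ≟ᶜ c)

    Side : Colour → Pred Dart _
    Side c = InFaceOf c ∪ OnBoundarySide c

    Side? : ∀ c → Decidable (Side c)
    Side? c = InFaceOf? c ∪? OnBoundarySide? c

    boundary-or-inner : ∀ d → (∃[ j ] boundaryDart j ≡ d) ⊎ Inner H d
    boundary-or-inner d with inBoundary? d
    ... | yes on-boundary = inj₁ (iter-onto-orbit boundary-isPeriod on-boundary)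
    ... | no inner = inj₂ inner

    InFaceOf-α : ∀ {c d} → InFaceOf c (α d) → Side (opposite c) d
    InFaceOf-α {c} {d} (inner-αd , colour-αd) with boundary-or-inner d
    ... | inj₂ inner-d = inj₁ (inner-d , trans (≢⇒≡opposite (proper H d inner-d inner-αd)) (cong opposite colour-αd))
    ... | inj₁ (j , refl) = inj₂ (j , refl , cong opposite (trans (sym (inner-across j inner-αd)) colour-αd))

    OnBoundarySide-α : ∀ {c} j → sideColour (lookup w j) ≡ c → Side (opposite c) (α (boundaryDart j))
    OnBoundarySide-α j side-j with boundary-or-inner (α (boundaryDart j))
    ... | inj₂ inner = inj₁ (inner , trans (inner-across j inner) (sideColour≡⇒expected side-j))
    ... | inj₁ (k , gk≡αgj) =
      inj₂ (k , gk≡αgj , trans (sideColour-distinct (letters-distinct j k (sym gk≡αgj) ∘ sym)) (sideColour≡⇒expected side-j))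

    Side-α : ∀ {c d} → Side c (α d) → Side (opposite c) d
    Side-α (inj₁ in-face) = InFaceOf-α in-face
    Side-α {d = d} (inj₂ (j , gj≡αd , side-j)) =
      subst (Side _) (trans (cong α gj≡αd) (α-invol d)) (OnBoundarySide-α j side-j)

    count-Side-white≡black : count (Side white) (Side? white) ≡ count (Side black) (Side? black)
    count-Side-white≡black = trans (count-permute (Side? white) α-permutation)
      (count-cong _ (Side? black) (Side-α , λ {d} side → Side-α (subst (Side black) (sym (α-invol d)) side)))

    count-Side : ∀ c → count (Side c) (Side? c) ≡ count (InFaceOf c) (InFaceOf? c) + occurrences c w
    count-Side c = trans (count-split (Side? c) (∁? inBoundary?)) (cong₂ _+_ inner-part boundary-part)
      where
      on-boundary : ∀ {d} → OnBoundarySide c d → InBoundary H d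
      on-boundary (j , refl , _) = boundaryDart-∈ j
      inner-part : count (Side c ∩ Inner H) (Side? c ∩? ∁? inBoundary?) ≡ count (InFaceOf c) (InFaceOf? c)
      inner-part = count-cong (Side? c ∩? ∁? inBoundary?) (InFaceOf? c)
        ( (λ { (inj₁ in-face , _) → in-face ; (inj₂ b , inner) → ⊥-elim (inner (on-boundary b)) })
        , λ in-face → inj₁ in-face , proj₁ in-face )
      boundary-part : count (Side c ∩ ∁ (Inner H)) (Side? c ∩? ∁? (∁? inBoundary?)) ≡ occurrences c w
      boundary-part = begin
        count (Side c ∩ ∁ (Inner H)) _
          ≡⟨ count-cong _ (inBoundary? ∩? OnBoundarySide? c)
               ( (λ { (inj₁ (inner , _) , ¬inner) → ⊥-elim (¬inner inner) ; (inj₂ b , _) → on-boundary b , b })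
               , λ (on , b) → inj₂ b , λ inner → inner on ) ⟩
        count (InBoundary H ∩ OnBoundarySide c) _
          ≡⟨ count-orbit boundary-isPeriod (OnBoundarySide? c) ⟩
        count (OnBoundarySide c ∘ boundaryDart) _
          ≡⟨ count-cong (OnBoundarySide? c ∘ boundaryDart) (λ j → sideColour (lookup w j) ≟ᶜ c)
               ( (λ { (k , e , side) → subst (λ i → sideColour (lookup w i) ≡ c) (iter-injective-below boundary-isPeriod e) side })
               , λ {j} side → j , refl , side ) ⟩
        occurrences c w ∎
        where open ≡-Reasoning

    side-balance : count (InFaceOf white) (InFaceOf? white) + occurrences white w
                 ≡ count (InFaceOf black) (InFaceOf? black) + occurrences black w
    side-balance = trans (sym (count-Side white)) (trans count-Side-white≡black (count-Side black))

lemma2 : (m p r : ℕ) → 2 ≤ m →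
    Σ PlanarHypermapWB (λ H → IsConstellation m H × HasBoundaryCondition H (bword p r)) →
    m ∣ p
lemma2 m p r _ (H , constellation , boundary) =
  ∣m+n∣m⇒∣n (subst (m ∣_) white≡black+p (constellation-divisible constellation white))
            (constellation-divisible constellation black)
  where
  open Hypermap H
  W B : ℕ
  W = count (InFaceOf white) (InFaceOf? white)
  B = count (InFaceOf black) (InFaceOf? black)
  white≡black+p : W ≡ B + p
  white≡black+p = ℕ.+-cancelʳ-≡ r W (B + p) (begin
    W + r                                  ≡⟨ cong (W +_) (sym (occurrences-white-bword p r)) ⟩
    W + occurrences white (bword p r)      ≡⟨ side-balance (bword p r) boundary ⟩
    B + occurrences black (bword p r)      ≡⟨ cong (B +_) (occurrences-black-bword p r) ⟩
    B + (p + r)                            ≡⟨ sym (ℕ.+-assoc B p r) ⟩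
    B + p + r                              ∎)
    where open ≡-Reasoning
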